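{- There are no graphs $G$ and $H$ such that the direct product $G\times H$ is a minimum counterexample to the statement "$\chi(F)\le \mathrm{toi}(F)$ for every graph $F$".
   Context: All graphs are finite, simple and loopless; $\chi$ is the chromatic number. A graph $G$ contains a graph $F$ as a totally odd strong immersion if there is an injective map $\varphi: V(F)\to V(G)$ (terminals) and, for each edge $uv\in E(F)$, a path in $G$ between $\varphi(u)$ and $\varphi(v)$, such that these paths are pairwise edge-disjoint, no terminal is an interior vertex of any of them, and each has an odd number of edges. $\mathrm{toi}(G)$ is the maximum $t$ such that $G$ contains $K_t$ as a totally odd strong immersion. A minimum counterexample is a graph $F$ with $\chi(F)>\mathrm{toi}(F)$ such that every graph with fewer vertices satisfies $\chi\le\mathrm{toi}$. The direct product $G\times H$ has vertex set $V(G)\times V(H)$, with $(g_1,h_1)\sim(g_2,h_2)$ iff $g_1g_2\in E(G)$ and $h_1h_2\in E(H)$. -}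

module Defs where

open import Data.Nat using (ℕ; zero; suc; _+_; _*_; _≤_; _<_)
open import Data.Fin using (Fin; zero; suc; inject₁; fromℕ; remQuot)
  renaming (_<_ to _<ᶠ_)
open import Data.Product using (Σ; ∃; ∃-syntax; _×_; _,_; proj₁; proj₂)
open import Data.Sum using (_⊎_)
open import Data.Empty using (⊥)
open import Relation.Nullary using (¬_)
open import Relation.Binary.PropositionalEquality using (_≡_; _≢_)
open import Function.Definitions using (Injective)

record Graph : Set₁ where
  field
    n      : ℕ
    Adj    : Fin n → Fin n → Set
    sym    : ∀ {x y} → Adj x y → Adj y x
    irrefl : ∀ {x} → ¬ Adj x x

open Graph public

V : Graph → Set
V G = Fin (n G)

-- Direct (tensor/categorical) product G × H, vertex set Fin (n G * n H)
-- identified with Fin (n G) × Fin (n H) via remQuot.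
_⊠_ : Graph → Graph → Graph
G ⊠ H = record
  { n      = n G * n H
  ; Adj    = λ x y → Adj G (proj₁ (pr x)) (proj₁ (pr y)) × Adj H (proj₂ (pr x)) (proj₂ (pr y))
  ; sym    = λ { (a , b) → sym G a , sym H b }
  ; irrefl = λ { (a , b) → irrefl G a }
  }
  where
  pr : Fin (n G * n H) → Fin (n G) × Fin (n H)
  pr = remQuot (n H)

Odd : ℕ → Set
Odd m = ∃[ k ] m ≡ suc (2 * k)

record Path (G : Graph) (x y : V G) : Set where
  field
    len   : ℕ
    vtx   : Fin (suc len) → V G
    start : vtx zero ≡ x
    end   : vtx (fromℕ len) ≡ y
    inj   : Injective _≡_ _≡_ vtx
    adj   : ∀ (e : Fin len) → Adj G (vtx (inject₁ e)) (vtx (suc e))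

open Path public

SameEdge : ∀ {G : Graph} → V G → V G → V G → V G → Set
SameEdge a b c d = (a ≡ c × b ≡ d) ⊎ (a ≡ d × b ≡ c)

record TOImmersion (G : Graph) (t : ℕ) : Set where
  field
    φ        : Fin t → V G
    φ-inj    : Injective _≡_ _≡_ φ
    path     : (i j : Fin t) → i <ᶠ j → Path G (φ i) (φ j)
    odd      : ∀ i j (p : i <ᶠ j) → Odd (len (path i j p))
    interior : ∀ i j (p : i <ᶠ j) (s : Fin t) (k : Fin (suc (len (path i j p)))) →
               vtx (path i j p) k ≡ φ s → k ≡ zero ⊎ k ≡ fromℕ (len (path i j p))
    disjoint : ∀ i j (p : i <ᶠ j) i' j' (p' : i' <ᶠ j')
               (e : Fin (len (path i j p))) (e' : Fin (len (path i' j' p'))) →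
               SameEdge {G}
                 (vtx (path i j p) (inject₁ e)) (vtx (path i j p) (suc e))
                 (vtx (path i' j' p') (inject₁ e')) (vtx (path i' j' p') (suc e')) →
               (i ≡ i' × j ≡ j')

IsTOI : Graph → ℕ → Set
IsTOI G t = TOImmersion G t × (∀ t' → TOImmersion G t' → t' ≤ t)

Colorable : Graph → ℕ → Set
Colorable G k = Σ (V G → Fin k) λ c → ∀ {x y : V G} → Adj G x y → c x ≢ c y

IsChi : Graph → ℕ → Set
IsChi G k = Colorable G k × (∀ k' → Colorable G k' → k ≤ k')

ChiLeToi : Graph → Set
ChiLeToi F = ∀ k t → IsChi F k → IsTOI F t → k ≤ t

MinCounterexample : Graph → Set₁
MinCounterexample F =
  (∃[ k ] ∃[ t ] (IsChi F k × IsTOI F t × t < k))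
  × (∀ (F' : Graph) → n F' < n F → ChiLeToi F')

{-# OPTIONS --safe #-}
-- If G or H has at most one vertex, G × H is edgeless and χ ≤ toi is immediate. Otherwise G
-- and H are smaller than G × H, so K_χ(G) and K_χ(H) immerse totally oddly in G and H. As
-- χ(G × H) ≤ min(χ(G), χ(H)), both contain K_χ(G × H), and the two immersions combine
-- coordinatewise: of two odd paths, the shorter is lengthened by going back and forth along
-- its first edge (an even detour) until both have the same length; the pair of paths is then
-- a path of G × H, injective thanks to the longer path, whose edges project onto edges of
-- the original paths, so edge-disjointness is inherited.
module Submission where

open import Defs
open import Relation.Nullary using (¬_; yes; no)
open import Data.Nat using (ℕ; zero; suc; _+_; _*_; _∸_; _≤_; _<_; _≤?_; z≤n; s≤s)
open import Data.Nat.Properties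
  using (≤-trans; ≤-total; ≮⇒≥; <⇒≱; ≰⇒>; n<1⇒n≡0; m<m*n; *-comm; m≤n⇒∃[o]m+o≡n; m∸[m∸n]≡n; ∸-monoʳ-≤)
open import Data.Nat.Induction using (<-rec)
open import Data.Nat.Tactic.RingSolver using (solve-∀)
open import Data.Fin using (Fin; zero; suc; inject₁; inject≤; fromℕ; toℕ; combine; remQuot)
  renaming (_<_ to _<ᶠ_)
open import Data.Fin.Properties
  using (toℕ-injective; toℕ<n; toℕ-inject≤; inject≤-injective; remQuot-combine; combine-injective; injective⇒≤)
open import Data.Product using (∃; ∃-syntax; _×_; _,_; proj₁; proj₂)
open import Data.Sum using (_⊎_; inj₁; inj₂)
open import Data.Empty using (⊥-elim)
open import Function using (id)
open import Function.Definitions using (Injective)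
open import Relation.Nullary.Decidable using (decidable-stable)
open import Relation.Binary.PropositionalEquality as ≡
  using (_≡_; refl; trans; cong; cong₂; subst; subst₂)

-- Adjacency is not decidable, so χ and toi exist only up to double negation; that suffices,
-- as every goal below is a negation or a decidable inequality.
¬¬-least : (P : ℕ → Set) {b : ℕ} → P b → ¬ ¬ (∃[ k ] P k × (∀ k′ → P k′ → k ≤ k′))
¬¬-least P {b} pb noLeast = <-rec (λ k → ¬ P k) notBelow b pb
  where
  notBelow : ∀ k → (∀ {j} → j < k → ¬ P j) → ¬ P k
  notBelow k below pk = noLeast (k , pk , λ j pj → ≮⇒≥ (λ j<k → below j<k pj))

-- The greatest t with P t is N ∸ d for the least d with P (N ∸ d).
¬¬-greatest : (P : ℕ → Set) {N : ℕ} → (∀ t → P t → t ≤ N) → {b : ℕ} → P b →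
              ¬ ¬ (∃[ k ] P k × (∀ k′ → P k′ → k′ ≤ k))
¬¬-greatest P {N} bound {b} pb noGreatest =
  ¬¬-least (λ d → P (N ∸ d)) {N ∸ b} (subst P (≡.sym (m∸[m∸n]≡n (bound b pb))) pb)
    λ (d , pd , least) → noGreatest (N ∸ d , pd , λ t pt →
      subst (_≤ N ∸ d) (m∸[m∸n]≡n (bound t pt))
        (∸-monoʳ-≤ N (least (N ∸ t) (subst P (≡.sym (m∸[m∸n]≡n (bound t pt))) pt))))

Edgeless : Graph → Set
Edgeless G = ∀ {x y} → ¬ Adj G x y

Edgeless-≤1 : (G : Graph) → n G ≤ 1 → Edgeless G
Edgeless-≤1 G G≤1 {x} {y} xy = irrefl G (subst (Adj G x) (≡.sym x≡y) xy)
  where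
  toℕ≡0 : (v : V G) → toℕ v ≡ 0
  toℕ≡0 v = n<1⇒n≡0 (≤-trans (toℕ<n v) G≤1)
  x≡y : x ≡ y
  x≡y = toℕ-injective (trans (toℕ≡0 x) (≡.sym (toℕ≡0 y)))

Colorable-id : (G : Graph) → Colorable G (n G)
Colorable-id G = id , λ {x} xy x≡y → irrefl G (subst (Adj G x) (≡.sym x≡y) xy)

Colorable-edgeless : (G : Graph) → Edgeless G → Colorable G 1
Colorable-edgeless G edgeless = (λ _ → zero) , λ xy → ⊥-elim (edgeless xy)

¬¬-χ : (G : Graph) → ¬ ¬ ∃ (IsChi G)
¬¬-χ G = ¬¬-least (Colorable G) (Colorable-id G)

TOImmersion-0 : (G : Graph) → TOImmersion G 0
TOImmersion-0 G = record
  { φ = λ () ; φ-inj = λ {} ; path = λ () ; odd = λ () ; interior = λ () ; disjoint = λ () }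

TOImmersion-1 : (G : Graph) → V G → TOImmersion G 1
TOImmersion-1 G x = record
  { φ = λ _ → x
  ; φ-inj = λ { {zero} {zero} _ → refl }
  ; path = λ { zero zero () }
  ; odd = λ { zero zero () }
  ; interior = λ { zero zero () }
  ; disjoint = λ { zero zero () }
  }

TOImmersion-≤n : (G : Graph) → ∀ t → TOImmersion G t → t ≤ n G
TOImmersion-≤n G t I = injective⇒≤ (TOImmersion.φ-inj I)

TOImmersion-restrict : {G : Graph} {t m : ℕ} → TOImmersion G t → m ≤ t → TOImmersion G m
TOImmersion-restrict {t = t} {m} I m≤t = record
  { φ = λ i → φ (ι i)
  ; φ-inj = λ eq → ι-injective (φ-inj eq)
  ; path = λ i j p → path (ι i) (ι j) (ι-mono p)
  ; odd = λ i j p → odd (ι i) (ι j) (ι-mono p)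
  ; interior = λ i j p s → interior (ι i) (ι j) (ι-mono p) (ι s)
  ; disjoint = λ i j p i′ j′ p′ e e′ same →
      let (i≡i′ , j≡j′) = disjoint (ι i) (ι j) (ι-mono p) (ι i′) (ι j′) (ι-mono p′) e e′ same
      in ι-injective i≡i′ , ι-injective j≡j′
  }
  where
  open TOImmersion I
  ι : Fin m → Fin t
  ι i = inject≤ i m≤t
  ι-injective : Injective _≡_ _≡_ ι
  ι-injective = inject≤-injective m≤t m≤t _ _
  ι-mono : ∀ {i j} → i <ᶠ j → ι i <ᶠ ι j
  ι-mono {i} {j} = subst₂ _<_ (≡.sym (toℕ-inject≤ i m≤t)) (≡.sym (toℕ-inject≤ j m≤t))

¬¬-toi : (G : Graph) → ¬ ¬ ∃ (IsTOI G)
¬¬-toi G = ¬¬-greatest (TOImmersion G) (TOImmersion-≤n G) (TOImmersion-0 G)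

ChiLeToi-edgeless : (F : Graph) → Edgeless F → ChiLeToi F
ChiLeToi-edgeless F edgeless k (suc t) (_ , χ-least) _ =
  ≤-trans (χ-least 1 (Colorable-edgeless F edgeless)) (s≤s z≤n)
ChiLeToi-edgeless F edgeless k zero (_ , χ-least) (_ , toi-greatest) =
  χ-least 0 ((λ x → ⊥-elim (noVertex x)) , λ {x} _ → ⊥-elim (noVertex x))
  where
  noVertex : ¬ V F
  noVertex x = <⇒≱ (s≤s z≤n) (toi-greatest 1 (TOImmersion-1 F x))

ChiLeToi⇒¬¬immersion : {G : Graph} → ChiLeToi G → ¬ ¬ (∃[ k ] Colorable G k × TOImmersion G k)
ChiLeToi⇒¬¬immersion {G} χ≤toi noImmersion =
  ¬¬-χ G λ (k , χ) → ¬¬-toi G λ (t , toi) →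
  noImmersion (k , proj₁ χ , TOImmersion-restrict (proj₁ toi) (χ≤toi k t χ toi))

Endpoint : {L : ℕ} → Fin (suc L) → Set
Endpoint {L} k = k ≡ zero ⊎ k ≡ fromℕ L

NotInterior : {G : Graph} {x y : V G} → Path G x y → V G → Set
NotInterior P a = ∀ k → vtx P k ≡ a → Endpoint k

SamePathEdge : {G : Graph} {x y x′ y′ : V G} (P : Path G x y) → Fin (len P) → (P′ : Path G x′ y′) → Fin (len P′) → Set
SamePathEdge {G} P e P′ e′ =
  SameEdge {G} (vtx P (inject₁ e)) (vtx P (suc e)) (vtx P′ (inject₁ e′)) (vtx P′ (suc e′))

data Step {L : ℕ} : Fin (suc L) → Fin (suc L) → Set where
  forth : (e : Fin L) → Step (inject₁ e) (suc e)
  back  : (e : Fin L) → Step (suc e) (inject₁ e)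

Step-edge : {L : ℕ} {i j : Fin (suc L)} → Step i j → Fin L
Step-edge (forth e) = e
Step-edge (back e)  = e

module _ {G : Graph} where

  SameEdge-swapˡ : {a b c d : V G} → SameEdge {G} a b c d → SameEdge {G} b a c d
  SameEdge-swapˡ (inj₁ (a≡c , b≡d)) = inj₂ (b≡d , a≡c)
  SameEdge-swapˡ (inj₂ (a≡d , b≡c)) = inj₁ (b≡c , a≡d)

  SameEdge-swapʳ : {a b c d : V G} → SameEdge {G} a b c d → SameEdge {G} a b d c
  SameEdge-swapʳ (inj₁ (a≡c , b≡d)) = inj₂ (a≡c , b≡d)
  SameEdge-swapʳ (inj₂ (a≡d , b≡c)) = inj₁ (a≡d , b≡c)

  Step-adj : {x y : V G} (P : Path G x y) {i j : Fin (suc (len P))} → Step i j → Adj G (vtx P i) (vtx P j)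
  Step-adj P (forth e) = adj P e
  Step-adj P (back e)  = Graph.sym G (adj P e)

  Step-sameEdge : {x y x′ y′ : V G} (P : Path G x y) (P′ : Path G x′ y′)
                  {i j : Fin (suc (len P))} {i′ j′ : Fin (suc (len P′))} (s : Step i j) (s′ : Step i′ j′) →
                  SameEdge {G} (vtx P i) (vtx P j) (vtx P′ i′) (vtx P′ j′) →
                  SamePathEdge P (Step-edge s) P′ (Step-edge s′)
  Step-sameEdge P P′ (forth e) (forth e′) same = same
  Step-sameEdge P P′ (forth e) (back e′)  same = SameEdge-swapʳ same
  Step-sameEdge P P′ (back e)  (forth e′) same = SameEdge-swapˡ same
  Step-sameEdge P P′ (back e)  (back e′)  same = SameEdge-swapˡ (SameEdge-swapʳ same)

-- A walk of length N from 0 to L along the path graph 0 — 1 — ⋯ — L.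
record Zigzag (N L : ℕ) : Set where
  field
    idx       : Fin (suc N) → Fin (suc L)
    idx-first : idx zero ≡ zero
    idx-last  : idx (fromℕ N) ≡ fromℕ L
    idx-step  : (e : Fin N) → Step (idx (inject₁ e)) (idx (suc e))

open Zigzag

Zigzag-refl : {L : ℕ} → Zigzag L L
Zigzag-refl = record { idx = id ; idx-first = refl ; idx-last = refl ; idx-step = forth }

Zigzag-bounce : {N L : ℕ} → Zigzag N (suc L) → Zigzag (2 + N) (suc L)
Zigzag-bounce {N} {L} Z = record { idx = idx′ ; idx-first = refl ; idx-last = idx-last Z ; idx-step = step′ }
  where
  idx′ : Fin (3 + N) → Fin (2 + L)
  idx′ zero = zero
  idx′ (suc zero) = suc zero
  idx′ (suc (suc k)) = idx Z k
  step′ : (e : Fin (2 + N)) → Step (idx′ (inject₁ e)) (idx′ (suc e))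
  step′ zero = forth zero
  step′ (suc zero) = subst (Step (suc zero)) (≡.sym (idx-first Z)) (back zero)
  step′ (suc (suc e)) = idx-step Z e

Zigzag-bounces : {N L : ℕ} (d : ℕ) → Zigzag N (suc L) → Zigzag (d * 2 + N) (suc L)
Zigzag-bounces zero Z = Z
Zigzag-bounces (suc d) Z = Zigzag-bounce (Zigzag-bounces d Z)

Zigzag-odd : {a b : ℕ} → a ≤ b → Zigzag (suc (2 * b)) (suc (2 * a))
Zigzag-odd {a} a≤b with m≤n⇒∃[o]m+o≡n a≤b
... | d , refl = subst (λ N → Zigzag N (suc (2 * a))) (gap a d) (Zigzag-bounces d Zigzag-refl)
  where
  gap : ∀ a d → d * 2 + suc (2 * a) ≡ suc (2 * (a + d))
  gap = solve-∀

Zigzag-endpoint : {N L : ℕ} (Z : Zigzag N L) → Injective _≡_ _≡_ (idx Z) →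
                  {k : Fin (suc N)} → Endpoint (idx Z k) → Endpoint k
Zigzag-endpoint Z idx-injective (inj₁ k↦0) = inj₁ (idx-injective (trans k↦0 (≡.sym (idx-first Z))))
Zigzag-endpoint Z idx-injective (inj₂ k↦L) = inj₂ (idx-injective (trans k↦L (≡.sym (idx-last Z))))

record Synchrony (L M N : ℕ) : Set where
  field
    left     : Zigzag N L
    right    : Zigzag N M
    faithful : Injective _≡_ _≡_ (idx left) ⊎ Injective _≡_ _≡_ (idx right)

open Synchrony

synchronise : {L M : ℕ} → Odd L → Odd M → ∃[ N ] Odd N × Synchrony L M N
synchronise (a , refl) (b , refl) with ≤-total a b
... | inj₁ a≤b = _ , (b , refl) , record { left = Zigzag-odd a≤b ; right = Zigzag-refl ; faithful = inj₂ id }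
... | inj₂ b≤a = _ , (a , refl) , record { left = Zigzag-refl ; right = Zigzag-odd b≤a ; faithful = inj₁ id }

module _ {G H : Graph} where

  pair : V G → V H → V (G ⊠ H)
  pair = combine

  pair-injective : {a a′ : V G} {b b′ : V H} → pair a b ≡ pair a′ b′ → a ≡ a′ × b ≡ b′
  pair-injective = combine-injective _ _ _ _

  Adj-pair : {a a′ : V G} {b b′ : V H} → Adj G a a′ → Adj H b b′ → Adj (G ⊠ H) (pair a b) (pair a′ b′)
  Adj-pair {a} {a′} {b} {b′} aa′ bb′ =
    subst₂ (Adj G) (cong proj₁ (remQuot-combine-sym a b)) (cong proj₁ (remQuot-combine-sym a′ b′)) aa′ ,
    subst₂ (Adj H) (cong proj₂ (remQuot-combine-sym a b)) (cong proj₂ (remQuot-combine-sym a′ b′)) bb′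
    where
    remQuot-combine-sym : (a : V G) (b : V H) → (a , b) ≡ remQuot (n H) (pair a b)
    remQuot-combine-sym a b = ≡.sym (remQuot-combine a b)

  SameEdge-pair⇒proj₁ : {a c a′ c′ : V G} {b d b′ d′ : V H} →
                        SameEdge {G ⊠ H} (pair a b) (pair c d) (pair a′ b′) (pair c′ d′) →
                        SameEdge {G} a c a′ c′
  SameEdge-pair⇒proj₁ (inj₁ (p , q)) = inj₁ (proj₁ (pair-injective p) , proj₁ (pair-injective q))
  SameEdge-pair⇒proj₁ (inj₂ (p , q)) = inj₂ (proj₁ (pair-injective p) , proj₁ (pair-injective q))

  Edgeless-⊠ˡ : Edgeless G → Edgeless (G ⊠ H)
  Edgeless-⊠ˡ edgeless (aa′ , _) = edgeless aa′

  Edgeless-⊠ʳ : Edgeless H → Edgeless (G ⊠ H)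
  Edgeless-⊠ʳ edgeless (_ , bb′) = edgeless bb′

  Colorable-⊠ˡ : {k : ℕ} → Colorable G k → Colorable (G ⊠ H) k
  Colorable-⊠ˡ (c , proper) = (λ v → c (proj₁ (remQuot (n H) v))) , λ (aa′ , _) → proper aa′

  Colorable-⊠ʳ : {k : ℕ} → Colorable H k → Colorable (G ⊠ H) k
  Colorable-⊠ʳ (c , proper) = (λ v → c (proj₂ (remQuot {n G} (n H) v))) , λ (_ , bb′) → proper bb′

  module _ {x y : V G} {x′ y′ : V H} (P : Path G x y) (Q : Path H x′ y′) {N : ℕ}
           (S : Synchrony (len P) (len Q) N) where

    zipPath : Path (G ⊠ H) (pair x x′) (pair y y′)
    zipPath = record
      { len   = N
      ; vtx   = λ k → pair (vtx P (idx (left S) k)) (vtx Q (idx (right S) k))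
      ; start = cong₂ pair (trans (cong (vtx P) (idx-first (left S))) (start P))
                           (trans (cong (vtx Q) (idx-first (right S))) (start Q))
      ; end   = cong₂ pair (trans (cong (vtx P) (idx-last (left S))) (end P))
                           (trans (cong (vtx Q) (idx-last (right S))) (end Q))
      ; inj   = injective
      ; adj   = λ e → Adj-pair (Step-adj P (idx-step (left S) e)) (Step-adj Q (idx-step (right S) e))
      }
      where
      injective : Injective _≡_ _≡_ (λ k → pair (vtx P (idx (left S) k)) (vtx Q (idx (right S) k)))
      injective eq with faithful S | pair-injective eq
      ... | inj₁ left-injective  | (p , _) = left-injective (inj P p)
      ... | inj₂ right-injective | (_ , q) = right-injective (inj Q q)

    zipPath-notInterior : {a : V G} {b : V H} → NotInterior P a → NotInterior Q b → NotInterior zipPath (pair a b)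
    zipPath-notInterior notInteriorP notInteriorQ k eq with faithful S | pair-injective eq
    ... | inj₁ left-injective  | (p , _) = Zigzag-endpoint (left S) left-injective (notInteriorP _ p)
    ... | inj₂ right-injective | (_ , q) = Zigzag-endpoint (right S) right-injective (notInteriorQ _ q)

  zipPath-sameEdge : {x y x₂ y₂ : V G} {x′ y′ x₂′ y₂′ : V H}
                     (P : Path G x y) (Q : Path H x′ y′) {N : ℕ} (S : Synchrony (len P) (len Q) N)
                     (P₂ : Path G x₂ y₂) (Q₂ : Path H x₂′ y₂′) {N₂ : ℕ} (S₂ : Synchrony (len P₂) (len Q₂) N₂)
                     (e : Fin N) (e₂ : Fin N₂) →
                     SamePathEdge (zipPath P Q S) e (zipPath P₂ Q₂ S₂) e₂ →
                     SamePathEdge P (Step-edge (idx-step (left S) e)) P₂ (Step-edge (idx-step (left S₂) e₂))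
  zipPath-sameEdge P Q S P₂ Q₂ S₂ e e₂ same =
    Step-sameEdge P P₂ (idx-step (left S) e) (idx-step (left S₂) e₂) (SameEdge-pair⇒proj₁ same)

  TOImmersion-⊠ : {t : ℕ} → TOImmersion G t → TOImmersion H t → TOImmersion (G ⊠ H) t
  TOImmersion-⊠ I J = record
    { φ        = λ i → pair (I.φ i) (J.φ i)
    ; φ-inj    = λ eq → I.φ-inj (proj₁ (pair-injective eq))
    ; path     = λ i j p → zipPath (I.path i j p) (J.path i j p) (synchrony i j p)
    ; odd      = λ i j p → proj₁ (proj₂ (sync i j p))
    ; interior = λ i j p s → zipPath-notInterior (I.path i j p) (J.path i j p) (synchrony i j p)
                               (I.interior i j p s) (J.interior i j p s)
    ; disjoint = λ i j p i′ j′ p′ e e′ same →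
        I.disjoint i j p i′ j′ p′ _ _
          (zipPath-sameEdge (I.path i j p) (J.path i j p) (synchrony i j p)
                            (I.path i′ j′ p′) (J.path i′ j′ p′) (synchrony i′ j′ p′) e e′ same)
    }
    where
    module I = TOImmersion I
    module J = TOImmersion J
    sync : ∀ i j (p : i <ᶠ j) → ∃[ N ] Odd N × Synchrony (len (I.path i j p)) (len (J.path i j p)) N
    sync i j p = synchronise (I.odd i j p) (J.odd i j p)
    synchrony : ∀ i j (p : i <ᶠ j) → Synchrony (len (I.path i j p)) (len (J.path i j p)) (proj₁ (sync i j p))
    synchrony i j p = proj₂ (proj₂ (sync i j p))

ChiLeToi-⊠ : {G H : Graph} → ChiLeToi G → ChiLeToi H → ChiLeToi (G ⊠ H)
ChiLeToi-⊠ {G} {H} χ≤toiG χ≤toiH k t (_ , χ-least) (_ , toi-greatest) =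
  decidable-stable (k ≤? t) λ k≰t →
    ChiLeToi⇒¬¬immersion χ≤toiG λ (kG , colourG , immersionG) →
    ChiLeToi⇒¬¬immersion χ≤toiH λ (kH , colourH , immersionH) →
    k≰t (toi-greatest k (TOImmersion-⊠
      (TOImmersion-restrict immersionG (χ-least kG (Colorable-⊠ˡ {G} {H} colourG)))
      (TOImmersion-restrict immersionH (χ-least kH (Colorable-⊠ʳ {G} {H} colourH)))))

m<m*n-nontrivial : {m n : ℕ} → 1 < m → 1 < n → m < m * n
m<m*n-nontrivial {suc m} {n} _ = m<m*n (suc m) n

corollary7 : ∀ (G H : Graph) → ¬ MinCounterexample (G ⊠ H)
corollary7 G H ((k , t , χ , toi , t<k) , smaller-ok) = <⇒≱ t<k (χ≤toi k t χ toi)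
  where
  χ≤toi : ChiLeToi (G ⊠ H)
  χ≤toi with n G ≤? 1 | n H ≤? 1
  ... | yes G≤1 | _       = ChiLeToi-edgeless (G ⊠ H) (Edgeless-⊠ˡ {G} {H} (Edgeless-≤1 G G≤1))
  ... | no _    | yes H≤1 = ChiLeToi-edgeless (G ⊠ H) (Edgeless-⊠ʳ {G} {H} (Edgeless-≤1 H H≤1))
  ... | no G≰1  | no H≰1  = ChiLeToi-⊠ (smaller-ok G G<G⊠H) (smaller-ok H H<G⊠H)
    where
    G<G⊠H : n G < n G * n H
    G<G⊠H = m<m*n-nontrivial (≰⇒> G≰1) (≰⇒> H≰1)
    H<G⊠H : n H < n G * n H
    H<G⊠H = subst (n H <_) (*-comm (n H) (n G)) (m<m*n-nontrivial (≰⇒> H≰1) (≰⇒> G≰1))
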